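{- Let $D\geq 1$ be an integer. Then the number of pairs $(m_1,m_2)\in(\mathbb{Z}/D\mathbb{Z})^2$ with $m_1^2\equiv m_2^2 \pmod{D}$ equals $c(D)\,D$, where $c$ is the multiplicative function determined on prime powers $p^k$ ($k\ge1$) by \[ c(p^k)= \begin{cases} k & \text{if } p=2,\\ 1+k-k/p & \text{if } p \text{ is odd.} \end{cases} \] -}

module Defs where

open import Data.Nat using (ℕ; zero; suc; _*_; _%_; _≟_)
open import Data.Fin using (Fin; toℕ)
open import Data.List using (List; length; filter; cartesianProduct; allFin)
open import Data.Product using (_×_; _,_)
open import Data.Integer using (+_)
open import Data.Rational using (ℚ; _+_; _-_; _/_; 0ℚ; 1ℚ)
import Data.Rational as ℚ

sqPairCount : ℕ → ℕ
sqPairCount zero = 0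
sqPairCount D@(suc _) =
  length (filter (λ { (m₁ , m₂) → ((toℕ m₁ * toℕ m₁) % D) ≟ ((toℕ m₂ * toℕ m₂) % D) })
                 (cartesianProduct (allFin D) (allFin D)))

⟦_⟧ : ℕ → ℚ
⟦ n ⟧ = + n / 1

-- The prescribed value c(p^k) for a prime p and k ≥ 1:
--   k            if p = 2
--   1 + k - k/p  if p is odd
-- (the clause for p = 0 is junk and never used, since p is prime)
cPrimePower : ℕ → ℕ → ℚ
cPrimePower zero k = 0ℚ
cPrimePower 2 k = ⟦ k ⟧
cPrimePower p@(suc _) k = (1ℚ + ⟦ k ⟧) - (+ k / p)

{-# OPTIONS --safe #-}
module Submission where

-- Write N(D) for the number of pairs.  By the Chinese remainder theorem the condition
-- a² ≡ b² (mod mn) splits into the same condition mod m and mod n, so N is multiplicative,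
-- as is D ↦ c(D)·D, and two multiplicative functions that agree on prime powers agree.
-- On a prime power D substitute a = b + x, which turns a² ≡ b² into D ∣ x(x + 2b).
-- If D is odd, b ↦ x + 2b permutes the residues, so N(D) = M(D), the number of pairs (x, y)
-- with D ∣ xy; splitting x by its residue mod p gives a recursion for M whose solution is
-- N(pᵏ) = pᵏ + k·pᵏ⁻¹(p − 1) = c(pᵏ)·pᵏ.  If D = 4P, only even x = 2q contribute, namely when
-- P ∣ q(q + b), so N(4P) = 8·M(P), which gives N(2ᵏ) = k·2ᵏ.

open import Algebra.Bundles using (CommutativeMonoid)
open import Data.Fin as Fin using (Fin; toℕ)
open import Data.Fin.Properties using (toℕ<n)
import Data.Integer as ℤ
import Data.Integer.Properties as ℤ
open import Data.List using ([]; _∷_; _++_; map; length; filter; cartesianProduct; tabulate; allFin)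
open import Data.List.Properties using (map-++; map-∘; map-cong; map-tabulate)
import Data.List.Relation.Unary.All as All
open import Data.Nat
open import Data.Nat.Coprimality using (Coprime; coprime-divisor; 1-coprimeTo) renaming (sym to coprime-sym)
open import Data.Nat.Divisibility
open import Data.Nat.DivMod
open import Data.Nat.Induction using (<-rec)
open import Data.Nat.ListAction using (sum; product)
open import Data.Nat.ListAction.Properties using (sum-++)
open import Data.Nat.Primality using (Prime; prime⇒irreducible; prime⇒nonZero; prime⇒nonTrivial; prime[2])
open import Data.Nat.Primality.Factorisation using (factorise)
open import Data.Nat.Properties
import Algebra.Properties.Semiring.Sum +-*-semiring as FinSum
open import Data.Nat.Tactic.RingSolver using (solve)
open import Data.Product using (_×_; _,_; proj₁; proj₂; ∃; ∃₂)
open import Data.Rational as ℚ using (ℚ; 1ℚ; fromℚᵘ; toℚᵘ)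
open import Data.Rational.Properties using (toℚᵘ-injective; toℚᵘ-fromℚᵘ; toℚᵘ-homo-*; toℚᵘ-homo-+; fromℚᵘ-cong)
import Data.Rational.Properties as ℚ
open import Data.Rational.Solver using (module +-*-Solver)
open import Data.Rational.Unnormalised as ℚᵘ using (mkℚᵘ; *≡*)
import Data.Rational.Unnormalised.Properties as ℚᵘ
open import Data.Sum using (inj₁; inj₂)
open import Function using (_∘_; id; _⇔_; mk⇔; Equivalence)
open import Relation.Binary.PropositionalEquality
  using (_≡_; _≢_; refl; sym; trans; cong; cong₂; subst; module ≡-Reasoning)
open import Relation.Nullary using (Dec; yes; no; ¬_; contradiction)
open import Relation.Unary using (Decidable)

open import Algebra.Properties.CommutativeSemigroup (CommutativeMonoid.commutativeSemigroup ℚ.*-1-commutativeMonoid)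
  using () renaming (interchange to *-interchange)
open import Defs

open ≡-Reasoning

-- Finite sums over initial segments of ℕ

∑ : ℕ → (ℕ → ℕ) → ℕ
∑ n f = FinSum.sum {n} (f ∘ toℕ)

syntax ∑ n (λ i → e) = ∑[ i < n ] e

∑-cong : ∀ n {f g : ℕ → ℕ} → (∀ i → i < n → f i ≡ g i) → ∑ n f ≡ ∑ n g
∑-cong n f≗g = FinSum.sum-cong-≗ {n} (λ i → f≗g (toℕ i) (toℕ<n i))

∑-const : ∀ n c → ∑[ i < n ] c ≡ n * c
∑-const zero    c = refl
∑-const (suc n) c = cong (c +_) (∑-const n c)

∑-zero : ∀ n {f : ℕ → ℕ} → (∀ i → i < n → f i ≡ 0) → ∑ n f ≡ 0
∑-zero n f≡0 = trans (∑-cong n f≡0) (trans (∑-const n 0) (*-zeroʳ n))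

∑-distrib-+ : ∀ n (f g : ℕ → ℕ) → ∑[ i < n ] (f i + g i) ≡ ∑ n f + ∑ n g
∑-distrib-+ n f g = FinSum.∑-distrib-+ {n} (f ∘ toℕ) (g ∘ toℕ)

*-distribˡ-∑ : ∀ n c (f : ℕ → ℕ) → c * ∑ n f ≡ ∑[ i < n ] (c * f i)
*-distribˡ-∑ n c f = FinSum.*-distribˡ-sum {n} c (f ∘ toℕ)

*-distribʳ-∑ : ∀ n c (f : ℕ → ℕ) → ∑ n f * c ≡ ∑[ i < n ] (f i * c)
*-distribʳ-∑ n c f = FinSum.*-distribʳ-sum {n} c (f ∘ toℕ)

∑-comm : ∀ m n (f : ℕ → ℕ → ℕ) → ∑[ i < m ] ∑[ j < n ] f i j ≡ ∑[ j < n ] ∑[ i < m ] f i j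
∑-comm m n f = FinSum.∑-comm {m} {n} (λ i j → f (toℕ i) (toℕ j))

∑-+ : ∀ m n (f : ℕ → ℕ) → ∑ (m + n) f ≡ ∑ m f + ∑[ i < n ] f (m + i)
∑-+ zero    n f = refl
∑-+ (suc m) n f = trans (cong (f 0 +_) (∑-+ m n (f ∘ suc))) (sym (+-assoc (f 0) _ _))

∑-* : ∀ m n (f : ℕ → ℕ) → ∑ (m * n) f ≡ ∑[ q < m ] ∑[ r < n ] f (q * n + r)
∑-* zero    n f = refl
∑-* (suc m) n f = begin
  ∑ (n + m * n) f                                          ≡⟨ ∑-+ n (m * n) f ⟩
  ∑ n f + ∑[ i < m * n ] f (n + i)                         ≡⟨ cong (∑ n f +_) (∑-* m n (f ∘ (n +_))) ⟩
  ∑ n f + ∑[ q < m ] ∑[ r < n ] f (n + (q * n + r))        ≡⟨ cong (∑ n f +_) (∑-cong m λ q _ → ∑-cong n λ r _ →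
                                                                cong f (sym (+-assoc n (q * n) r))) ⟩
  ∑ n f + ∑[ q < m ] ∑[ r < n ] f (n + q * n + r)          ∎

Periodic : (n : ℕ) .{{_ : NonZero n}} → (ℕ → ℕ) → Set
Periodic n f = ∀ i → f i ≡ f (i % n)

periodic-shift : ∀ {n} .{{_ : NonZero n}} {f : ℕ → ℕ} → Periodic n f → ∀ q r → r < n → f (q * n + r) ≡ f r
periodic-shift {n} {f} f-per q r r<n = begin
  f (q * n + r)         ≡⟨ f-per (q * n + r) ⟩
  f ((q * n + r) % n)   ≡⟨ cong f (trans (cong (_% n) (+-comm (q * n) r)) ([m+kn]%n≡m%n r q n)) ⟩
  f (r % n)             ≡⟨ cong f (m<n⇒m%n≡m r<n) ⟩
  f r                   ∎

∑-periodic : ∀ t n .{{_ : NonZero n}} {f : ℕ → ℕ} → Periodic n f → ∑ (t * n) f ≡ t * ∑ n f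
∑-periodic t n {f} f-per = begin
  ∑ (t * n) f                              ≡⟨ ∑-* t n f ⟩
  ∑[ q < t ] ∑[ r < n ] f (q * n + r)      ≡⟨ ∑-cong t (λ q _ → ∑-cong n (periodic-shift f-per q)) ⟩
  ∑[ q < t ] ∑ n f                         ≡⟨ ∑-const t (∑ n f) ⟩
  t * ∑ n f                                ∎

-- Indicators and permutations

χ : {P : Set} → Dec P → ℕ
χ (yes _) = 1
χ (no  _) = 0

χ-cong : {P Q : Set} → P ⇔ Q → (P? : Dec P) (Q? : Dec Q) → χ P? ≡ χ Q?
χ-cong P⇔Q (yes _) (yes _) = refl
χ-cong P⇔Q (yes p) (no ¬q) = contradiction (Equivalence.to P⇔Q p) ¬q
χ-cong P⇔Q (no ¬p) (yes q) = contradiction (Equivalence.from P⇔Q q) ¬p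
χ-cong P⇔Q (no _)  (no _)  = refl

χ-× : {P Q R : Set} → P ⇔ (Q × R) → (P? : Dec P) (Q? : Dec Q) (R? : Dec R) → χ P? ≡ χ Q? * χ R?
χ-× P⇔Q×R (yes _) (yes _) (yes _) = refl
χ-× P⇔Q×R (yes p) (yes _) (no ¬r) = contradiction (proj₂ (Equivalence.to P⇔Q×R p)) ¬r
χ-× P⇔Q×R (yes p) (no ¬q) _       = contradiction (proj₁ (Equivalence.to P⇔Q×R p)) ¬q
χ-× P⇔Q×R (no ¬p) (yes q) (yes r) = contradiction (Equivalence.from P⇔Q×R (q , r)) ¬p
χ-× P⇔Q×R (no _)  (yes _) (no _)  = refl
χ-× P⇔Q×R (no _)  (no _)  _       = refl

χ-yes : {P : Set} (P? : Dec P) → P → χ P? ≡ 1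
χ-yes (yes _) _ = refl
χ-yes (no ¬p) p = contradiction p ¬p

χ-no : {P : Set} (P? : Dec P) → ¬ P → χ P? ≡ 0
χ-no (yes p) ¬p = contradiction p ¬p
χ-no (no _)  _  = refl

∑-δ : ∀ n {x} (h : ℕ → ℕ) → x < n → ∑[ y < n ] (χ (x ≟ y) * h y) ≡ h x
∑-δ (suc n) {zero}  h _ = begin
  h 0 + 0 + ∑[ y < n ] 0   ≡⟨ cong₂ _+_ (+-identityʳ (h 0)) (∑-zero n λ _ _ → refl) ⟩
  h 0 + 0                  ≡⟨ +-identityʳ (h 0) ⟩
  h 0                      ∎
∑-δ (suc n) {suc x} h (s<s x<n) =
  trans (∑-cong n λ y _ → cong (_* h (suc y)) (χ-cong (mk⇔ suc-injective (cong suc)) (suc x ≟ suc y) (x ≟ y)))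
        (∑-δ n (h ∘ suc) x<n)

∑χ≤1 : ∀ n {P : ℕ → Set} (P? : ∀ i → Dec (P i)) →
  (∀ {i j} → i < n → j < n → P i → P j → i ≡ j) → ∑[ i < n ] χ (P? i) ≤ 1
∑χ≤1 zero    P? unique = z≤n
∑χ≤1 (suc n) P? unique with P? 0
... | yes p₀ = ≤-reflexive (cong suc (∑-zero n λ i i<n →
                 χ-no (P? (suc i)) λ pᵢ → 0≢1+n (unique z<s (s<s i<n) p₀ pᵢ)))
... | no  _  = ∑χ≤1 n (P? ∘ suc) λ i<n j<n pᵢ pⱼ → suc-injective (unique (s<s i<n) (s<s j<n) pᵢ pⱼ)

∑≤n : ∀ n {f : ℕ → ℕ} → (∀ i → i < n → f i ≤ 1) → ∑ n f ≤ n
∑≤n zero    f≤1 = z≤n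
∑≤n (suc n) f≤1 = +-mono-≤ (f≤1 0 z<s) (∑≤n n λ i i<n → f≤1 (suc i) (s<s i<n))

a+b≡1+n⇒a≡1∧b≡n : ∀ {a b n} → a ≤ 1 → b ≤ n → a + b ≡ suc n → a ≡ 1 × b ≡ n
a+b≡1+n⇒a≡1∧b≡n z≤n       b≤n refl = contradiction b≤n (n≮n _)
a+b≡1+n⇒a≡1∧b≡n (s≤s z≤n) _   eq   = refl , suc-injective eq

∑≡n⇒≡1 : ∀ n {f : ℕ → ℕ} → (∀ i → i < n → f i ≤ 1) → ∑ n f ≡ n → ∀ i → i < n → f i ≡ 1
∑≡n⇒≡1 (suc n) {f} f≤1 ∑f≡1+n = λ where
    zero    _         → proj₁ head≡1∧∑tail≡n
    (suc i) (s<s i<n) → ∑≡n⇒≡1 n tail≤1 (proj₂ head≡1∧∑tail≡n) i i<n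
  where
  tail≤1 : ∀ i → i < n → f (suc i) ≤ 1
  tail≤1 i i<n = f≤1 (suc i) (s<s i<n)
  head≡1∧∑tail≡n : f 0 ≡ 1 × ∑ n (f ∘ suc) ≡ n
  head≡1∧∑tail≡n = a+b≡1+n⇒a≡1∧b≡n (f≤1 0 z<s) (∑≤n n tail≤1) ∑f≡1+n

∑-permute : ∀ n (σ : ℕ → ℕ) → (∀ j → j < n → σ j < n) → (∀ {i j} → i < n → j < n → σ i ≡ σ j → i ≡ j) →
  (h : ℕ → ℕ) → ∑[ j < n ] h (σ j) ≡ ∑ n h
∑-permute n σ σ<n σ-inj h = begin
  ∑[ j < n ] h (σ j)                              ≡⟨ ∑-cong n (λ j j<n → sym (∑-δ n h (σ<n j j<n))) ⟩
  ∑[ j < n ] ∑[ y < n ] (χ (σ j ≟ y) * h y)       ≡⟨ ∑-comm n n (λ j y → χ (σ j ≟ y) * h y) ⟩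
  ∑[ y < n ] ∑[ j < n ] (χ (σ j ≟ y) * h y)       ≡⟨ ∑-cong n (λ y _ → *-distribʳ-∑ n (h y) (fibreχ y)) ⟨
  ∑[ y < n ] (fibre y * h y)                      ≡⟨ ∑-cong n (λ y y<n → cong (_* h y) (fibre≡1 y y<n)) ⟩
  ∑[ y < n ] (1 * h y)                            ≡⟨ ∑-cong n (λ y _ → *-identityˡ (h y)) ⟩
  ∑ n h                                           ∎
  where
  -- every fibre of σ has at most one point and the fibre sizes add up to n, so all fibres are singletons
  fibreχ : ℕ → ℕ → ℕ
  fibreχ y j = χ (σ j ≟ y)
  fibre : ℕ → ℕ
  fibre y = ∑ n (fibreχ y)
  ∑fibre≡n : ∑ n fibre ≡ n
  ∑fibre≡n = begin
    ∑[ y < n ] ∑[ j < n ] χ (σ j ≟ y)         ≡⟨ ∑-comm n n fibreχ ⟩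
    ∑[ j < n ] ∑[ y < n ] χ (σ j ≟ y)         ≡⟨ ∑-cong n (λ j j<n → trans (∑-cong n λ y _ → sym (*-identityʳ (fibreχ y j)))
                                                                          (∑-δ n (λ _ → 1) (σ<n j j<n))) ⟩
    ∑[ j < n ] 1                              ≡⟨ ∑-const n 1 ⟩
    n * 1                                     ≡⟨ *-identityʳ n ⟩
    n                                         ∎
  fibre≡1 : ∀ y → y < n → fibre y ≡ 1
  fibre≡1 = ∑≡n⇒≡1 n (λ y _ → ∑χ≤1 n (λ j → σ j ≟ y) λ i<n j<n eᵢ eⱼ → σ-inj i<n j<n (trans eᵢ (sym eⱼ)))
                   ∑fibre≡n

-- Congruences

%≡%⇒∣∸ : ∀ a b {n} .{{_ : NonZero n}} → a % n ≡ b % n → n ∣ b ∸ a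
%≡%⇒∣∸ a b {n} a≡b = divides (b / n ∸ a / n) (begin
  b ∸ a                                        ≡⟨ cong₂ _∸_ (m≡m%n+[m/n]*n b n) (m≡m%n+[m/n]*n a n) ⟩
  (b % n + b / n * n) ∸ (a % n + a / n * n)    ≡⟨ cong (λ r → (b % n + b / n * n) ∸ (r + a / n * n)) a≡b ⟩
  (b % n + b / n * n) ∸ (b % n + a / n * n)    ≡⟨ [m+n]∸[m+o]≡n∸o (b % n) _ _ ⟩
  b / n * n ∸ a / n * n                        ≡⟨ *-distribʳ-∸ n (b / n) (a / n) ⟨
  (b / n ∸ a / n) * n                          ∎)

%≡%⇔∣∸ : ∀ {a b n} .{{_ : NonZero n}} → a ≤ b → (a % n ≡ b % n) ⇔ (n ∣ b ∸ a)
%≡%⇔∣∸ {a} {b} {n} a≤b = mk⇔ (%≡%⇒∣∸ a b) λ n∣b∸a → begin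
  a % n                 ≡⟨ %-remove-+ʳ a n∣b∸a ⟨
  (a + (b ∸ a)) % n     ≡⟨ cong (_% n) (m+[n∸m]≡n a≤b) ⟩
  b % n                 ∎

[m+n]%d≡m%d⇔d∣n : ∀ m n {d} .{{_ : NonZero d}} → ((m + n) % d ≡ m % d) ⇔ (d ∣ n)
[m+n]%d≡m%d⇔d∣n m n = mk⇔ (λ eq → subst (_ ∣_) (m+n∸m≡n m n) (%≡%⇒∣∸ m (m + n) (sym eq))) (%-remove-+ʳ m)

[m*n]%d≡[m*[n%d]]%d : ∀ m n d .{{_ : NonZero d}} → (m * n) % d ≡ (m * (n % d)) % d
[m*n]%d≡[m*[n%d]]%d m n d = begin
  (m * n) % d                      ≡⟨ %-distribˡ-* m n d ⟩
  (m % d * (n % d)) % d            ≡⟨ cong (λ r → (m % d * r) % d) (m%n%n≡m%n n d) ⟨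
  (m % d * (n % d % d)) % d        ≡⟨ %-distribˡ-* m (n % d) d ⟨
  (m * (n % d)) % d                ∎

coprime-∣*∣ : ∀ {m n k} → Coprime m n → m ∣ k → n ∣ k → m * n ∣ k
coprime-∣*∣ {m} {n} m⊥n (divides q refl) n∣qm =
  subst (_∣ q * m) (*-comm n m) (*-monoˡ-∣ m (coprime-divisor (coprime-sym m⊥n) (subst (n ∣_) (*-comm q m) n∣qm)))

%-crt≤ : ∀ {m n a b} .{{_ : NonZero m}} .{{_ : NonZero n}} .{{_ : NonZero (m * n)}} → Coprime m n → a ≤ b →
  (a % (m * n) ≡ b % (m * n)) ⇔ (a % m ≡ b % m × a % n ≡ b % n)
%-crt≤ {m} {n} m⊥n a≤b = mk⇔
  (λ eq → let mn∣d = to (%≡%⇔∣∸ a≤b) eq in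
          from (%≡%⇔∣∸ a≤b) (m*n∣⇒m∣ m n mn∣d) , from (%≡%⇔∣∸ a≤b) (m*n∣⇒n∣ m n mn∣d))
  (λ (eqₘ , eqₙ) → from (%≡%⇔∣∸ a≤b) (coprime-∣*∣ m⊥n (to (%≡%⇔∣∸ a≤b) eqₘ) (to (%≡%⇔∣∸ a≤b) eqₙ)))
  where open Equivalence

%-crt : ∀ {m n} .{{_ : NonZero m}} .{{_ : NonZero n}} .{{_ : NonZero (m * n)}} → Coprime m n →
  ∀ a b → (a % (m * n) ≡ b % (m * n)) ⇔ (a % m ≡ b % m × a % n ≡ b % n)
%-crt m⊥n a b with ≤-total a b
... | inj₁ a≤b = %-crt≤ m⊥n a≤b
... | inj₂ b≤a = mk⇔ (λ eq → let (eqₘ , eqₙ) = to (%-crt≤ m⊥n b≤a) (sym eq) in sym eqₘ , sym eqₙ)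
                     (λ (eqₘ , eqₙ) → sym (from (%-crt≤ m⊥n b≤a) (sym eqₘ , sym eqₙ)))
  where open Equivalence

affine-injective : ∀ {n} .{{_ : NonZero n}} c a → Coprime a n → ∀ {i j} → i < n → j < n →
  (c + a * i) % n ≡ (c + a * j) % n → i ≡ j
affine-injective {n} c a a⊥n i<n j<n eq = ≤-antisym (≤-from i<n (sym eq)) (≤-from j<n eq)
  where
  -- j ∸ i is truncated, so this needs no assumption on the order of i and j.
  ≤-from : ∀ {i j} → j < n → (c + a * i) % n ≡ (c + a * j) % n → j ≤ i
  ≤-from {i} {j} j<n eq = m∸n≡0⇒m≤n (begin
    j ∸ i         ≡⟨ m<n⇒m%n≡m (≤-<-trans (m∸n≤m j i) j<n) ⟨
    (j ∸ i) % n   ≡⟨ n∣m⇒m%n≡0 _ n n∣j∸i ⟩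
    0             ∎)
    where
    n∣j∸i : n ∣ j ∸ i
    n∣j∸i = coprime-divisor (coprime-sym a⊥n)
      (subst (n ∣_) (trans ([m+n]∸[m+o]≡n∸o c _ _) (sym (*-distribˡ-∸ a j i))) (%≡%⇒∣∸ _ _ eq))

∑-affine : ∀ n .{{_ : NonZero n}} c a → Coprime a n → {h : ℕ → ℕ} → Periodic n h →
  ∑[ j < n ] h (c + a * j) ≡ ∑ n h
∑-affine n c a a⊥n {h} h-per = begin
  ∑[ j < n ] h (c + a * j)          ≡⟨ ∑-cong n (λ j _ → h-per (c + a * j)) ⟩
  ∑[ j < n ] h ((c + a * j) % n)    ≡⟨ ∑-permute n (λ j → (c + a * j) % n) (λ j _ → m%n<n _ n) (affine-injective c a a⊥n) h ⟩
  ∑ n h                             ∎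

∑-crt : ∀ m n .{{_ : NonZero m}} .{{_ : NonZero n}} → Coprime m n → {f g : ℕ → ℕ} → Periodic m f → Periodic n g →
  ∑[ x < m * n ] (f x * g x) ≡ ∑ m f * ∑ n g
∑-crt m n m⊥n {f} {g} f-per g-per = begin
  ∑[ x < m * n ] (f x * g x)                            ≡⟨ ∑-* m n (λ x → f x * g x) ⟩
  ∑[ q < m ] ∑[ r < n ] (f (q * n + r) * g (q * n + r)) ≡⟨ ∑-cong m (λ q _ → ∑-cong n λ r r<n →
                                                             cong₂ _*_ (cong f (reorder q r)) (periodic-shift g-per q r r<n)) ⟩
  ∑[ q < m ] ∑[ r < n ] (f (r + n * q) * g r)           ≡⟨ ∑-comm m n (λ q r → f (r + n * q) * g r) ⟩
  ∑[ r < n ] ∑[ q < m ] (f (r + n * q) * g r)           ≡⟨ ∑-cong n (λ r _ → *-distribʳ-∑ m (g r) (λ q → f (r + n * q))) ⟨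
  ∑[ r < n ] (∑[ q < m ] f (r + n * q) * g r)           ≡⟨ ∑-cong n (λ r _ → cong (_* g r) (∑-affine m r n n⊥m f-per)) ⟩
  ∑[ r < n ] (∑ m f * g r)                              ≡⟨ *-distribˡ-∑ n (∑ m f) g ⟨
  ∑ m f * ∑ n g                                         ∎
  where
  n⊥m = coprime-sym m⊥n
  reorder : ∀ q r → q * n + r ≡ r + n * q
  reorder q r = trans (+-comm (q * n) r) (cong (r +_) (*-comm q n))

periodic-∣ : ∀ {m n} .{{_ : NonZero m}} .{{_ : NonZero n}} {f : ℕ → ℕ} → m ∣ n → Periodic m f → Periodic n f
periodic-∣ {m} {n} {f} m∣n f-per y = begin
  f y              ≡⟨ f-per y ⟩
  f (y % m)        ≡⟨ cong f (m∣n⇒o%n%m≡o%m m n y m∣n) ⟨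
  f (y % n % m)    ≡⟨ f-per (y % n) ⟨
  f (y % n)        ∎

prime∤⇒coprime : ∀ {p n} → Prime p → ¬ p ∣ n → Coprime p n
prime∤⇒coprime p-prime p∤n (d∣p , d∣n) with prime⇒irreducible p-prime d∣p
... | inj₁ d≡1    = d≡1
... | inj₂ refl   = contradiction d∣n p∤n

coprime-*ˡ : ∀ {a b c} → Coprime a c → Coprime b c → Coprime (a * b) c
coprime-*ˡ {a} a⊥c b⊥c {d} (d∣ab , d∣c) = b⊥c (coprime-divisor d⊥a d∣ab , d∣c)
  where
  d⊥a : Coprime d a
  d⊥a (e∣d , e∣a) = a⊥c (e∣a , ∣-trans e∣d d∣c)

coprime-^ˡ : ∀ {a c} → Coprime a c → ∀ k → Coprime (a ^ k) c
coprime-^ˡ a⊥c zero    = 1-coprimeTo _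
coprime-^ˡ a⊥c (suc k) = coprime-*ˡ a⊥c (coprime-^ˡ a⊥c k)

-- Multiplicative functions

∃-prime∣ : ∀ n .{{_ : NonTrivial n}} → ∃ λ p → Prime p × p ∣ n
∃-prime∣ n with factorise n {{nonTrivial⇒nonZero n}}
... | record { factors = [] ; isFactorisation = n≡1 } = contradiction n≡1 nonTrivial⇒≢1
... | record { factors = p ∷ ps ; isFactorisation = n≡p*∏ps ; factorsPrime = p-prime All.∷ _ } =
  p , p-prime , divides (product ps) (trans n≡p*∏ps (*-comm p (product ps)))

factorOut : ∀ {p} → Prime p → ∀ n .{{_ : NonZero n}} → p ∣ n → ∃₂ λ k m → n ≡ p ^ suc k * m × ¬ p ∣ m
factorOut {p} p-prime = <-rec Factorable factor
  where
  Factorable : ℕ → Set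
  Factorable n = .{{_ : NonZero n}} → p ∣ n → ∃₂ λ k m → n ≡ p ^ suc k * m × ¬ p ∣ m
  factor : ∀ n → (∀ {m} → m < n → Factorable m) → Factorable n
  factor n rec p∣n@(divides q n≡q*p) with p ∣? q
  ... | no  p∤q = 0 , q , trans n≡q*p (trans (*-comm q p) (cong (_* q) (sym (*-identityʳ p)))) , p∤q
  ... | yes p∣q with k , m , q≡pᵏm , p∤m ← rec (quotient-< p∣n {{prime⇒nonTrivial p-prime}}) {{quotient≢0 p∣n}} p∣q =
    suc k , m , trans n≡q*p (trans (cong (_* p) q≡pᵏm) (rotate (p ^ suc k) m p)) , p∤m
    where
    rotate : ∀ x m p → x * m * p ≡ p * x * m
    rotate x m p = solve (x ∷ m ∷ p ∷ [])

module _ {A : Set} (_∙_ : A → A → A) where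

  Multiplicative : (ℕ → A) → Set
  Multiplicative f = ∀ m n .{{_ : NonZero m}} .{{_ : NonZero n}} → Coprime m n → f (m * n) ≡ f m ∙ f n

  multiplicative-ext : ∀ {f g : ℕ → A} → Multiplicative f → Multiplicative g → f 1 ≡ g 1 →
    (∀ {p} → Prime p → ∀ k → f (p ^ suc k) ≡ g (p ^ suc k)) → ∀ n .{{_ : NonZero n}} → f n ≡ g n
  multiplicative-ext {f} {g} f-mult g-mult f1≡g1 f≡g-primePower = <-rec Agree agree
    where
    Agree : ℕ → Set
    Agree n = .{{_ : NonZero n}} → f n ≡ g n
    agree : ∀ n → (∀ {m} → m < n → Agree m) → Agree n
    agree 1 _ = f1≡g1
    agree n@(suc (suc _)) rec
      with p , p-prime , p∣n ← ∃-prime∣ n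
      with k , m , n≡Pm , p∤m ← factorOut p-prime n p∣n = begin
        f n          ≡⟨ cong f n≡Pm ⟩
        f (P * m)    ≡⟨ f-mult P m P⊥m ⟩
        f P ∙ f m    ≡⟨ cong₂ _∙_ (f≡g-primePower p-prime k) (rec m<n) ⟩
        g P ∙ g m    ≡⟨ g-mult P m P⊥m ⟨
        g (P * m)    ≡⟨ cong g n≡Pm ⟨
        g n          ∎
      where
      P = p ^ suc k
      instance
        p≢0 : NonZero p
        p≢0 = prime⇒nonZero p-prime
        P≢0 : NonZero P
        P≢0 = m^n≢0 p (suc k)
        m≢0 : NonZero m
        m≢0 = ≢-nonZero λ m≡0 → p∤m (subst (p ∣_) (sym m≡0) (p ∣0))
      P⊥m : Coprime P m
      P⊥m = coprime-^ˡ (prime∤⇒coprime p-prime p∤m) (suc k)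
      1<P : 1 < P
      1<P = <-≤-trans (nonTrivial⇒n>1 p {{prime⇒nonTrivial p-prime}}) (m≤m*n p (p ^ k) {{m^n≢0 p k}})
      m<n : m < n
      m<n = subst (m <_) (trans (*-comm m P) (sym n≡Pm)) (m<m*n m P 1<P)

-- Counting square pairs

length-filter : ∀ {A : Set} {P : A → Set} (P? : Decidable P) xs → length (filter P? xs) ≡ sum (map (χ ∘ P?) xs)
length-filter P? []       = refl
length-filter P? (x ∷ xs) with P? x
... | yes _ = cong suc (length-filter P? xs)
... | no  _ = length-filter P? xs

sum-map-cartesianProduct : ∀ {A B : Set} (g : A × B → ℕ) xs ys →
  sum (map g (cartesianProduct xs ys)) ≡ sum (map (λ x → sum (map (λ y → g (x , y)) ys)) xs)
sum-map-cartesianProduct g []       ys = refl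
sum-map-cartesianProduct g (x ∷ xs) ys = begin
  sum (map g (map (x ,_) ys ++ cartesianProduct xs ys))                 ≡⟨ cong sum (map-++ g (map (x ,_) ys) _) ⟩
  sum (map g (map (x ,_) ys) ++ map g (cartesianProduct xs ys))         ≡⟨ sum-++ (map g (map (x ,_) ys)) _ ⟩
  sum (map g (map (x ,_) ys)) + sum (map g (cartesianProduct xs ys))    ≡⟨ cong₂ _+_ (cong sum (sym (map-∘ ys)))
                                                                                     (sum-map-cartesianProduct g xs ys) ⟩
  sum (map (λ y → g (x , y)) ys) + sum (map (λ x → sum (map (λ y → g (x , y)) ys)) xs) ∎

sum-tabulate : ∀ n (g : Fin n → ℕ) → sum (tabulate g) ≡ FinSum.sum g
sum-tabulate zero    g = refl
sum-tabulate (suc n) g = cong (g Fin.zero +_) (sum-tabulate n (g ∘ Fin.suc))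

sum-map-allFin : ∀ n (h : ℕ → ℕ) → sum (map (h ∘ toℕ) (allFin n)) ≡ ∑ n h
sum-map-allFin n h = trans (cong sum (map-tabulate {n = n} id (h ∘ toℕ))) (sum-tabulate n (h ∘ toℕ))

sqEq : (D : ℕ) .{{_ : NonZero D}} → ℕ → ℕ → ℕ
sqEq D a b = χ (a * a % D ≟ b * b % D)

sqPairs : (D : ℕ) .{{_ : NonZero D}} → ℕ
sqPairs D = ∑[ a < D ] ∑[ b < D ] sqEq D a b

sqPairCount≡sqPairs : ∀ D .{{_ : NonZero D}} → sqPairCount D ≡ sqPairs D
sqPairCount≡sqPairs (suc d) = begin
  length (filter P? (cartesianProduct residues residues))
    ≡⟨ length-filter P? (cartesianProduct residues residues) ⟩
  sum (map (χ ∘ P?) (cartesianProduct residues residues))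
    ≡⟨ sum-map-cartesianProduct (χ ∘ P?) residues residues ⟩
  sum (map (λ x → sum (map (λ y → sqEq D (toℕ x) (toℕ y)) residues)) residues)
    ≡⟨ cong sum (map-cong (λ x → sum-map-allFin D (sqEq D (toℕ x))) residues) ⟩
  sum (map (λ x → ∑ D (sqEq D (toℕ x))) residues)
    ≡⟨ sum-map-allFin D (λ a → ∑ D (sqEq D a)) ⟩
  sqPairs D
    ∎
  where
  D = suc d
  residues = allFin D
  P? : Decidable (λ ((x , y) : Fin D × Fin D) → toℕ x * toℕ x % D ≡ toℕ y * toℕ y % D)
  P? (x , y) = toℕ x * toℕ x % D ≟ toℕ y * toℕ y % D

sqEq-periodicˡ : ∀ D .{{_ : NonZero D}} b → Periodic D (λ a → sqEq D a b)
sqEq-periodicˡ D b a = cong (λ r → χ (r ≟ b * b % D)) (%-distribˡ-* a a D)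

sqEq-periodicʳ : ∀ D .{{_ : NonZero D}} a → Periodic D (sqEq D a)
sqEq-periodicʳ D a b = cong (λ r → χ (a * a % D ≟ r)) (%-distribˡ-* b b D)

sqEq-crt : ∀ m n .{{_ : NonZero m}} .{{_ : NonZero n}} .{{_ : NonZero (m * n)}} → Coprime m n →
  ∀ a b → sqEq (m * n) a b ≡ sqEq m a b * sqEq n a b
sqEq-crt m n m⊥n a b = χ-× (%-crt m⊥n (a * a) (b * b))
  (a * a % (m * n) ≟ b * b % (m * n)) (a * a % m ≟ b * b % m) (a * a % n ≟ b * b % n)

sqPairs-multiplicative : ∀ m n .{{_ : NonZero m}} .{{_ : NonZero n}} → Coprime m n →
  sqPairs (m * n) {{m*n≢0 m n}} ≡ sqPairs m * sqPairs n
sqPairs-multiplicative m n m⊥n = begin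
  ∑[ a < m * n ] ∑[ b < m * n ] sqEq (m * n) a b                    ≡⟨ ∑-cong (m * n) (λ a _ → ∑-cong (m * n) λ b _ →
                                                                         sqEq-crt m n m⊥n a b) ⟩
  ∑[ a < m * n ] ∑[ b < m * n ] (sqEq m a b * sqEq n a b)          ≡⟨ ∑-cong (m * n) (λ a _ →
                                                                         ∑-crt m n m⊥n (sqEq-periodicʳ m a) (sqEq-periodicʳ n a)) ⟩
  ∑[ a < m * n ] (∑ m (sqEq m a) * ∑ n (sqEq n a))                  ≡⟨ ∑-crt m n m⊥n (rowSum-periodic m) (rowSum-periodic n) ⟩
  sqPairs m * sqPairs n                                             ∎
  where
  instance
    mn≢0 : NonZero (m * n)
    mn≢0 = m*n≢0 m n
  rowSum-periodic : ∀ D .{{_ : NonZero D}} → Periodic D (λ a → ∑ D (sqEq D a))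
  rowSum-periodic D a = ∑-cong D (λ b _ → sqEq-periodicˡ D b a)

sqPairCount-multiplicative : Multiplicative _*_ sqPairCount
sqPairCount-multiplicative m n m⊥n = begin
  sqPairCount (m * n)               ≡⟨ sqPairCount≡sqPairs (m * n) {{m*n≢0 m n}} ⟩
  sqPairs (m * n) {{m*n≢0 m n}}     ≡⟨ sqPairs-multiplicative m n m⊥n ⟩
  sqPairs m * sqPairs n             ≡⟨ cong₂ _*_ (sqPairCount≡sqPairs m) (sqPairCount≡sqPairs n) ⟨
  sqPairCount m * sqPairCount n     ∎

-- Prime powers

[_∣_] : ℕ → ℕ → ℕ
[ d ∣ n ] = χ (d ∣? n)

[∣]-cong-% : ∀ {d} .{{_ : NonZero d}} {m n} → m % d ≡ n % d → [ d ∣ m ] ≡ [ d ∣ n ]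
[∣]-cong-% {d} {m} {n} eq = χ-cong (mk⇔ (transport eq) (transport (sym eq))) (d ∣? m) (d ∣? n)
  where
  transport : ∀ {m n} → m % d ≡ n % d → d ∣ m → d ∣ n
  transport {m} {n} eq d∣m = m%n≡0⇒n∣m n d (trans (sym eq) (n∣m⇒m%n≡0 m d d∣m))

[∣*]-periodicʳ : ∀ d .{{_ : NonZero d}} x → Periodic d (λ y → [ d ∣ x * y ])
[∣*]-periodicʳ d x y = [∣]-cong-% ([m*n]%d≡[m*[n%d]]%d x y d)

[∣*]-periodicˡ : ∀ d .{{_ : NonZero d}} y → Periodic d (λ x → [ d ∣ x * y ])
[∣*]-periodicˡ d y x = [∣]-cong-% (begin
  (x * y) % d          ≡⟨ cong (_% d) (*-comm x y) ⟩
  (y * x) % d          ≡⟨ [m*n]%d≡[m*[n%d]]%d y x d ⟩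
  (y * (x % d)) % d    ≡⟨ cong (_% d) (*-comm y (x % d)) ⟩
  (x % d * y) % d      ∎)

[*∣*] : ∀ c .{{_ : NonZero c}} d n → [ c * d ∣ c * n ] ≡ [ d ∣ n ]
[*∣*] c d n = χ-cong (mk⇔ (*-cancelˡ-∣ c) (*-monoʳ-∣ c)) (c * d ∣? c * n) (d ∣? n)

[coprime∣*] : ∀ {d x} → Coprime d x → ∀ y → [ d ∣ x * y ] ≡ [ d ∣ y ]
[coprime∣*] {d} {x} d⊥x y = χ-cong (mk⇔ (coprime-divisor d⊥x) (∣n⇒∣m*n x)) (d ∣? x * y) (d ∣? y)

∑-[∣] : ∀ d .{{_ : NonZero d}} → ∑[ y < d ] [ d ∣ y ] ≡ 1
∑-[∣] d@(suc d-1) = cong₂ _+_ (χ-yes (d ∣? 0) (d ∣0)) (∑-zero d-1 λ y y<d-1 →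
  χ-no (d ∣? suc y) λ d∣1+y → n≮n d (≤-<-trans (∣⇒≤ d∣1+y) (s<s y<d-1)))

sqDiffPairs : ℕ → ℕ
sqDiffPairs d = ∑[ x < d ] ∑[ b < d ] [ d ∣ x * (x + 2 * b) ]

zeroProductPairs : ℕ → ℕ
zeroProductPairs d = ∑[ x < d ] ∑[ y < d ] [ d ∣ x * y ]

sqPairs≡sqDiffPairs : ∀ D .{{_ : NonZero D}} → sqPairs D ≡ sqDiffPairs D
sqPairs≡sqDiffPairs D = begin
  ∑[ a < D ] ∑[ b < D ] sqEq D a b                      ≡⟨ ∑-comm D D (sqEq D) ⟩
  ∑[ b < D ] ∑[ a < D ] sqEq D a b                      ≡⟨ ∑-cong D (λ b _ → ∑-affine D b 1 1⊥D (sqEq-periodicˡ D b)) ⟨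
  ∑[ b < D ] ∑[ x < D ] sqEq D (b + 1 * x) b            ≡⟨ ∑-cong D (λ b _ → ∑-cong D λ x _ → sqEq-shift b x) ⟩
  ∑[ b < D ] ∑[ x < D ] [ D ∣ x * (x + 2 * b) ]         ≡⟨ ∑-comm D D (λ b x → [ D ∣ x * (x + 2 * b) ]) ⟩
  sqDiffPairs D                                          ∎
  where
  1⊥D = 1-coprimeTo D
  sqEq-shift : ∀ b x → sqEq D (b + 1 * x) b ≡ [ D ∣ x * (x + 2 * b) ]
  sqEq-shift b x = begin
    χ ((b + 1 * x) * (b + 1 * x) % D ≟ b * b % D)    ≡⟨ cong (λ s → χ (s % D ≟ b * b % D)) square-expand ⟩
    χ ((b * b + x * (x + 2 * b)) % D ≟ b * b % D)   ≡⟨ χ-cong ([m+n]%d≡m%d⇔d∣n (b * b) _) _ (D ∣? x * (x + 2 * b)) ⟩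
    [ D ∣ x * (x + 2 * b) ]                          ∎
    where
    square-expand : (b + 1 * x) * (b + 1 * x) ≡ b * b + x * (x + 2 * b)
    square-expand = solve (b ∷ x ∷ [])

sqPairCount≡sqDiffPairs : ∀ D .{{_ : NonZero D}} → sqPairCount D ≡ sqDiffPairs D
sqPairCount≡sqDiffPairs D = trans (sqPairCount≡sqPairs D) (sqPairs≡sqDiffPairs D)

sqDiffPairs≡zeroProductPairs : ∀ D .{{_ : NonZero D}} → Coprime 2 D → sqDiffPairs D ≡ zeroProductPairs D
sqDiffPairs≡zeroProductPairs D 2⊥D = ∑-cong D λ x _ → ∑-affine D x 2 2⊥D ([∣*]-periodicʳ D x)

-- M(p·pᵏ) = p·M(pᵏ) + pᵏ(p − 1) without subtraction.  Write x = qp + r: the residue r = 0 gives p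
-- copies of the count for pᵏ, and for each of the p − 1 others x is prime to p^(k+1), so only y = 0 counts.
zeroProductPairs-step : ∀ {p} → Prime p → ∀ k →
  zeroProductPairs (p ^ suc k) + p ^ k ≡ p * (zeroProductPairs (p ^ k) + p ^ k)
zeroProductPairs-step {suc p-1} p-prime k = begin
  ∑ (p * P) row + P                                   ≡⟨ cong (λ n → ∑ n row + P) (*-comm p P) ⟩
  ∑ (P * p) row + P                                   ≡⟨ cong (_+ P) (∑-* P p row) ⟩
  ∑[ q < P ] ∑[ r < p ] row (q * p + r) + P           ≡⟨ cong (_+ P) (∑-cong P λ q _ → row-sum q) ⟩
  ∑[ q < P ] (p * G q + p-1) + P                      ≡⟨ cong (_+ P) (∑-distrib-+ P (λ q → p * G q) (λ _ → p-1)) ⟩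
  ∑[ q < P ] (p * G q) + ∑[ q < P ] p-1 + P           ≡⟨ cong₂ (λ s t → s + t + P) (sym (*-distribˡ-∑ P p G))
                                                                                     (∑-const P p-1) ⟩
  p * ∑ P G + P * p-1 + P                             ≡⟨ regroup p-1 (∑ P G) P ⟩
  p * (∑ P G + P)                                     ∎
  where
  regroup : ∀ a m n → suc a * m + n * a + n ≡ suc a * (m + n)
  regroup a m n = solve (a ∷ m ∷ n ∷ [])
  p = suc p-1
  P = p ^ k
  instance
    P≢0 : NonZero P
    P≢0 = m^n≢0 p k
    pP≢0 : NonZero (p * P)
    pP≢0 = m*n≢0 p P
  row : ℕ → ℕ
  row x = ∑[ y < p * P ] [ p * P ∣ x * y ]
  G : ℕ → ℕ
  G q = ∑[ y < P ] [ P ∣ q * y ]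
  row-multiple : ∀ q → row (q * p + 0) ≡ p * G q
  row-multiple q = begin
    ∑[ y < p * P ] [ p * P ∣ (q * p + 0) * y ]   ≡⟨ ∑-cong (p * P) (λ y _ → cong ([ p * P ∣_]) (factor-out p q y)) ⟩
    ∑[ y < p * P ] [ p * P ∣ p * (q * y) ]       ≡⟨ ∑-cong (p * P) (λ y _ → [*∣*] p P (q * y)) ⟩
    ∑[ y < p * P ] [ P ∣ q * y ]                 ≡⟨ ∑-periodic p P ([∣*]-periodicʳ P q) ⟩
    p * G q                                      ∎
    where
    factor-out : ∀ p q y → (q * p + 0) * y ≡ p * (q * y)
    factor-out p q y = solve (p ∷ q ∷ y ∷ [])
  row-coprime : ∀ q r → r < p-1 → row (q * p + suc r) ≡ 1
  row-coprime q r r<p-1 = trans (∑-cong (p * P) λ y _ → [coprime∣*] pP⊥x y) (∑-[∣] (p * P))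
    where
    p∤x : ¬ p ∣ q * p + suc r
    p∤x p∣x = n≮n p (≤-<-trans (∣⇒≤ (∣m+n∣m⇒∣n p∣x (n∣m*n q))) (s<s r<p-1))
    pP⊥x : Coprime (p * P) (q * p + suc r)
    pP⊥x = coprime-^ˡ (prime∤⇒coprime p-prime p∤x) (suc k)

  row-sum : ∀ q → ∑[ r < p ] row (q * p + r) ≡ p * G q + p-1
  row-sum q = cong₂ _+_ (row-multiple q) (trans (∑-cong p-1 (row-coprime q)) (trans (∑-const p-1 1) (*-identityʳ p-1)))

-- M(p^(k+1)) = p^(k+1) + (k+1)·pᵏ(p − 1), stated without subtraction.
zeroProductPairs-primePower : ∀ {p} → Prime p → ∀ k →
  zeroProductPairs (p ^ suc k) + suc k * p ^ k ≡ suc (suc k) * p ^ suc k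
zeroProductPairs-primePower {p} p-prime zero = begin
  zeroProductPairs (p ^ 1) + 1        ≡⟨ zeroProductPairs-step p-prime 0 ⟩
  p * 2                               ≡⟨ solve (p ∷ []) ⟩
  2 * (p * 1)                         ∎
zeroProductPairs-primePower {p} p-prime (suc k) = begin
  zeroProductPairs (p * P) + suc (suc k) * P              ≡⟨ split-off (zeroProductPairs (p * P)) P k ⟩
  zeroProductPairs (p * P) + P + suc k * P                ≡⟨ cong (_+ suc k * P) (zeroProductPairs-step p-prime (suc k)) ⟩
  p * (zeroProductPairs P + P) + suc k * (p * p ^ k)      ≡⟨ exchange p (zeroProductPairs P) P k (p ^ k) ⟩
  p * (zeroProductPairs P + suc k * p ^ k) + p * P        ≡⟨ cong (λ t → p * t + p * P) (zeroProductPairs-primePower p-prime k) ⟩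
  p * (suc (suc k) * P) + p * P                           ≡⟨ collect p P k ⟩
  suc (suc (suc k)) * (p * P)                             ∎
  where
  P = p ^ suc k
  split-off : ∀ m n k → m + suc (suc k) * n ≡ m + n + suc k * n
  split-off m n k = solve (m ∷ n ∷ k ∷ [])
  exchange : ∀ p m n k y → p * (m + n) + suc k * (p * y) ≡ p * (m + suc k * y) + p * n
  exchange p m n k y = solve (p ∷ m ∷ n ∷ k ∷ y ∷ [])
  collect : ∀ p n k → p * (suc (suc k) * n) + p * n ≡ suc (suc (suc k)) * (p * n)
  collect p n k = solve (p ∷ n ∷ k ∷ [])

¬2∣1+2* : ∀ w → ¬ 2 ∣ 1 + 2 * w
¬2∣1+2* w 2∣1+2w = n≮n 1 (∣⇒≤ (∣m+n∣m⇒∣n (subst (2 ∣_) (+-comm 1 (2 * w)) 2∣1+2w) (m∣m*n w)))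

-- Odd x never satisfy 4P ∣ x(x + 2b), and for x = 2q the condition reads P ∣ q(q + b).
sqDiffPairs-4* : ∀ P .{{_ : NonZero P}} → sqDiffPairs (2 * (2 * P)) ≡ 8 * zeroProductPairs P
sqDiffPairs-4* P = begin
  ∑ D row                                        ≡⟨ cong (λ n → ∑ n row) (*-comm 2 (2 * P)) ⟩
  ∑ (2 * P * 2) row                              ≡⟨ ∑-* (2 * P) 2 row ⟩
  ∑[ q < 2 * P ] ∑[ r < 2 ] row (q * 2 + r)      ≡⟨ ∑-cong (2 * P) (λ q _ → cong₂ _+_ (row-even q) (cong (_+ 0) (row-odd q))) ⟩
  ∑[ q < 2 * P ] (4 * G q + (0 + 0))             ≡⟨ ∑-cong (2 * P) (λ q _ → +-identityʳ (4 * G q)) ⟩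
  ∑[ q < 2 * P ] (4 * G q)                       ≡⟨ *-distribˡ-∑ (2 * P) 4 G ⟨
  4 * ∑ (2 * P) G                                ≡⟨ cong (4 *_) (∑-periodic 2 P λ q → ∑-cong P λ y _ → [∣*]-periodicˡ P y q) ⟩
  4 * (2 * zeroProductPairs P)                   ≡⟨ *-assoc 4 2 (zeroProductPairs P) ⟨
  8 * zeroProductPairs P                         ∎
  where
  D = 2 * (2 * P)
  instance
    2P≢0 : NonZero (2 * P)
    2P≢0 = m*n≢0 2 P
    D≢0 : NonZero D
    D≢0 = m*n≢0 2 (2 * P)
  row : ℕ → ℕ
  row x = ∑[ b < D ] [ D ∣ x * (x + 2 * b) ]
  G : ℕ → ℕ
  G q = ∑[ y < P ] [ P ∣ q * y ]
  row-odd : ∀ q → row (q * 2 + 1) ≡ 0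
  row-odd q = ∑-zero D λ b _ → χ-no (D ∣? _) λ D∣x →
    ¬2∣1+2* (2 * q * q + 2 * q + 2 * q * b + b) (∣-trans (m∣m*n (2 * P)) (subst (D ∣_) (odd-square-form q b) D∣x))
    where
    odd-square-form : ∀ q b → (q * 2 + 1) * (q * 2 + 1 + 2 * b) ≡ 1 + 2 * (2 * q * q + 2 * q + 2 * q * b + b)
    odd-square-form q b = solve (q ∷ b ∷ [])
  row-even : ∀ q → row (q * 2 + 0) ≡ 4 * G q
  row-even q = begin
    ∑[ b < D ] [ D ∣ (q * 2 + 0) * (q * 2 + 0 + 2 * b) ]
      ≡⟨ ∑-cong D (λ b _ → cong [ D ∣_] (even-square-form q b)) ⟩
    ∑[ b < D ] [ 2 * (2 * P) ∣ 2 * (2 * (q * (q + 1 * b))) ]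
      ≡⟨ ∑-cong D (λ b _ → trans ([*∣*] 2 (2 * P) (2 * (q * (q + 1 * b)))) ([*∣*] 2 P (q * (q + 1 * b)))) ⟩
    ∑[ b < D ] [ P ∣ q * (q + 1 * b) ]
      ≡⟨ ∑-affine D q 1 (1-coprimeTo D) (periodic-∣ P∣D ([∣*]-periodicʳ P q)) ⟩
    ∑[ y < D ] [ P ∣ q * y ]
      ≡⟨ cong (λ n → ∑[ y < n ] [ P ∣ q * y ]) (*-assoc 2 2 P) ⟨
    ∑[ y < 4 * P ] [ P ∣ q * y ]
      ≡⟨ ∑-periodic 4 P ([∣*]-periodicʳ P q) ⟩
    4 * G q
      ∎
    where
    P∣D : P ∣ D
    P∣D = ∣n⇒∣m*n 2 (n∣m*n 2)
    even-square-form : ∀ q b → (q * 2 + 0) * (q * 2 + 0 + 2 * b) ≡ 2 * (2 * (q * (q + 1 * b)))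
    even-square-form q b = solve (q ∷ b ∷ [])

sqPairCount-2^ : ∀ k → sqPairCount (2 ^ suc k) ≡ suc k * 2 ^ suc k
sqPairCount-2^ zero          = refl
sqPairCount-2^ (suc zero)    = refl
sqPairCount-2^ (suc (suc k)) = +-cancelʳ-≡ (8 * (suc k * 2 ^ k)) _ _ (begin
  sqPairCount (2 * (2 * Q)) + 8 * (suc k * 2 ^ k)          ≡⟨ cong (_+ 8 * (suc k * 2 ^ k)) sqPairCount≡8*zeroProductPairs ⟩
  8 * zeroProductPairs Q + 8 * (suc k * 2 ^ k)             ≡⟨ *-distribˡ-+ 8 (zeroProductPairs Q) _ ⟨
  8 * (zeroProductPairs Q + suc k * 2 ^ k)                 ≡⟨ cong (8 *_) (zeroProductPairs-primePower prime[2] k) ⟩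
  8 * (suc (suc k) * Q)                                    ≡⟨ rearrange k (2 ^ k) ⟩
  suc (suc (suc k)) * (2 * (2 * Q)) + 8 * (suc k * 2 ^ k)  ∎)
  where
  Q = 2 ^ suc k
  instance
    Q≢0 : NonZero Q
    Q≢0 = m^n≢0 2 (suc k)
    4Q≢0 : NonZero (2 * (2 * Q))
    4Q≢0 = m^n≢0 2 (3 + k)
  sqPairCount≡8*zeroProductPairs : sqPairCount (2 * (2 * Q)) ≡ 8 * zeroProductPairs Q
  sqPairCount≡8*zeroProductPairs = trans (sqPairCount≡sqDiffPairs (2 * (2 * Q))) (sqDiffPairs-4* Q)
  rearrange : ∀ k y → 8 * (suc (suc k) * (2 * y)) ≡ suc (suc (suc k)) * (2 * (2 * (2 * y))) + 8 * (suc k * y)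
  rearrange k y = solve (k ∷ y ∷ [])

sqPairCount-oddPrimePower : ∀ {p} → Prime p → p ≢ 2 → ∀ k →
  sqPairCount (p ^ suc k) + suc k * p ^ k ≡ suc (suc k) * p ^ suc k
sqPairCount-oddPrimePower {p} p-prime p≢2 k = begin
  sqPairCount P + suc k * p ^ k          ≡⟨ cong (_+ suc k * p ^ k) (sqPairCount≡sqDiffPairs P) ⟩
  sqDiffPairs P + suc k * p ^ k          ≡⟨ cong (_+ suc k * p ^ k) (sqDiffPairs≡zeroProductPairs P 2⊥P) ⟩
  zeroProductPairs P + suc k * p ^ k     ≡⟨ zeroProductPairs-primePower p-prime k ⟩
  suc (suc k) * P                        ∎
  where
  P = p ^ suc k
  instance
    P≢0 : NonZero P
    P≢0 = m^n≢0 p (suc k) {{prime⇒nonZero p-prime}}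
  p∤2 : ¬ p ∣ 2
  p∤2 p∣2 = p≢2 (≤-antisym (∣⇒≤ p∣2) (nonTrivial⇒n>1 p {{prime⇒nonTrivial p-prime}}))
  2⊥P : Coprime 2 P
  2⊥P = coprime-sym (coprime-^ˡ (prime∤⇒coprime p-prime p∤2) (suc k))

-- Rational values

fromℚᵘ-homo-* : ∀ x y → fromℚᵘ (x ℚᵘ.* y) ≡ fromℚᵘ x ℚ.* fromℚᵘ y
fromℚᵘ-homo-* x y = toℚᵘ-injective (ℚᵘ.≃-trans (toℚᵘ-fromℚᵘ (x ℚᵘ.* y))
  (ℚᵘ.≃-sym (ℚᵘ.≃-trans (toℚᵘ-homo-* (fromℚᵘ x) (fromℚᵘ y)) (ℚᵘ.*-cong (toℚᵘ-fromℚᵘ x) (toℚᵘ-fromℚᵘ y)))))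

fromℚᵘ-homo-+ : ∀ x y → fromℚᵘ (x ℚᵘ.+ y) ≡ fromℚᵘ x ℚ.+ fromℚᵘ y
fromℚᵘ-homo-+ x y = toℚᵘ-injective (ℚᵘ.≃-trans (toℚᵘ-fromℚᵘ (x ℚᵘ.+ y))
  (ℚᵘ.≃-sym (ℚᵘ.≃-trans (toℚᵘ-homo-+ (fromℚᵘ x) (fromℚᵘ y)) (ℚᵘ.+-cong (toℚᵘ-fromℚᵘ x) (toℚᵘ-fromℚᵘ y)))))

⟦⟧-* : ∀ m n → ⟦ m * n ⟧ ≡ ⟦ m ⟧ ℚ.* ⟦ n ⟧
⟦⟧-* m n = trans (fromℚᵘ-cong {mkℚᵘ (ℤ.+ (m * n)) 0} {mkℚᵘ (ℤ.+ m) 0 ℚᵘ.* mkℚᵘ (ℤ.+ n) 0}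
                   (*≡* (cong (ℤ._* ℤ.+ 1) (ℤ.pos-* m n))))
                 (fromℚᵘ-homo-* (mkℚᵘ (ℤ.+ m) 0) (mkℚᵘ (ℤ.+ n) 0))

⟦⟧-+ : ∀ m n → ⟦ m + n ⟧ ≡ ⟦ m ⟧ ℚ.+ ⟦ n ⟧
⟦⟧-+ m n = trans (fromℚᵘ-cong {mkℚᵘ (ℤ.+ (m + n)) 0} {mkℚᵘ (ℤ.+ m) 0 ℚᵘ.+ mkℚᵘ (ℤ.+ n) 0}
                   (*≡* (cong (ℤ._* ℤ.+ 1) (trans (ℤ.pos-+ m n)
                     (sym (cong₂ ℤ._+_ (ℤ.*-identityʳ (ℤ.+ m)) (ℤ.*-identityʳ (ℤ.+ n))))))))
                 (fromℚᵘ-homo-+ (mkℚᵘ (ℤ.+ m) 0) (mkℚᵘ (ℤ.+ n) 0))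

/-*-cancel : ∀ k p .{{_ : NonZero p}} → (ℤ.+ k ℚ./ p) ℚ.* ⟦ p ⟧ ≡ ⟦ k ⟧
/-*-cancel k p@(suc p-1) = trans (sym (fromℚᵘ-homo-* (mkℚᵘ (ℤ.+ k) p-1) (mkℚᵘ (ℤ.+ p) 0)))
  (fromℚᵘ-cong {mkℚᵘ (ℤ.+ k) p-1 ℚᵘ.* mkℚᵘ (ℤ.+ p) 0} {mkℚᵘ (ℤ.+ k) 0}
    (*≡* (trans (ℤ.*-identityʳ _) (cong (λ d → ℤ.+ k ℤ.* ℤ.+ suc d) (sym (*-identityʳ p-1))))))

⟦⟧-primePowerValue : ∀ p .{{_ : NonZero p}} k N → N + suc k * p ^ k ≡ suc (suc k) * p ^ suc k →
  ⟦ N ⟧ ≡ ((1ℚ ℚ.+ ⟦ suc k ⟧) ℚ.- (ℤ.+ suc k ℚ./ p)) ℚ.* ⟦ p ^ suc k ⟧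
⟦⟧-primePowerValue p k N count = begin
  ⟦ N ⟧                                     ≡⟨ solveℚ 3 (λ n κ y → n := (n :+ κ :* y) :- κ :* y) refl ⟦ N ⟧ κ y ⟩
  (⟦ N ⟧ ℚ.+ κ ℚ.* y) ℚ.- κ ℚ.* y          ≡⟨ cong (λ t → t ℚ.- κ ℚ.* y) count′ ⟩
  (1ℚ ℚ.+ κ) ℚ.* (π ℚ.* y) ℚ.- κ ℚ.* y     ≡⟨ cong (λ t → (1ℚ ℚ.+ κ) ℚ.* (π ℚ.* y) ℚ.- t ℚ.* y) (/-*-cancel (suc k) p) ⟨
  (1ℚ ℚ.+ κ) ℚ.* (π ℚ.* y) ℚ.- u ℚ.* π ℚ.* y
                                            ≡⟨ solveℚ 4 (λ κ u π y → (con 1ℚ :+ κ) :* (π :* y) :- u :* π :* y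
                                                                    := ((con 1ℚ :+ κ) :- u) :* (π :* y)) refl κ u π y ⟩
  ((1ℚ ℚ.+ κ) ℚ.- u) ℚ.* (π ℚ.* y)         ≡⟨ cong (((1ℚ ℚ.+ κ) ℚ.- u) ℚ.*_) (⟦⟧-* p (p ^ k)) ⟨
  ((1ℚ ℚ.+ κ) ℚ.- u) ℚ.* ⟦ p ^ suc k ⟧     ∎
  where
  open +-*-Solver using (_:=_; _:+_; _:-_; _:*_; con) renaming (solve to solveℚ)
  κ = ⟦ suc k ⟧
  π = ⟦ p ⟧
  y = ⟦ p ^ k ⟧
  u = ℤ.+ suc k ℚ./ p
  count′ : ⟦ N ⟧ ℚ.+ κ ℚ.* y ≡ (1ℚ ℚ.+ κ) ℚ.* (π ℚ.* y)
  count′ = begin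
    ⟦ N ⟧ ℚ.+ κ ℚ.* y                   ≡⟨ cong (⟦ N ⟧ ℚ.+_) (⟦⟧-* (suc k) (p ^ k)) ⟨
    ⟦ N ⟧ ℚ.+ ⟦ suc k * p ^ k ⟧         ≡⟨ ⟦⟧-+ N (suc k * p ^ k) ⟨
    ⟦ N + suc k * p ^ k ⟧               ≡⟨ cong ⟦_⟧ count ⟩
    ⟦ (1 + suc k) * (p * p ^ k) ⟧       ≡⟨ ⟦⟧-* (1 + suc k) (p * p ^ k) ⟩
    ⟦ 1 + suc k ⟧ ℚ.* ⟦ p * p ^ k ⟧     ≡⟨ cong₂ ℚ._*_ (⟦⟧-+ 1 (suc k)) (⟦⟧-* p (p ^ k)) ⟩
    (1ℚ ℚ.+ κ) ℚ.* (π ℚ.* y)            ∎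

⟦sqPairCount⟧-primePower : ∀ {p} → Prime p → ∀ k → ⟦ sqPairCount (p ^ suc k) ⟧ ≡ cPrimePower p (suc k) ℚ.* ⟦ p ^ suc k ⟧
⟦sqPairCount⟧-primePower {2} _ k = trans (cong ⟦_⟧ (sqPairCount-2^ k)) (⟦⟧-* (suc k) (2 ^ suc k))
⟦sqPairCount⟧-primePower {p@(suc (suc (suc _)))} p-prime k =
  ⟦⟧-primePowerValue p k (sqPairCount (p ^ suc k)) (sqPairCount-oddPrimePower p-prime (λ ()) k)

⟦⟧∘-multiplicative : ∀ {f : ℕ → ℕ} → Multiplicative _*_ f → Multiplicative ℚ._*_ (⟦_⟧ ∘ f)
⟦⟧∘-multiplicative {f} f-mult m n m⊥n = trans (cong ⟦_⟧ (f-mult m n m⊥n)) (⟦⟧-* (f m) (f n))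

*⟦⟧-multiplicative : ∀ {c : ℕ → ℚ} → Multiplicative ℚ._*_ c → Multiplicative ℚ._*_ (λ n → c n ℚ.* ⟦ n ⟧)
*⟦⟧-multiplicative {c} c-mult m n m⊥n = begin
  c (m * n) ℚ.* ⟦ m * n ⟧                 ≡⟨ cong₂ ℚ._*_ (c-mult m n m⊥n) (⟦⟧-* m n) ⟩
  (c m ℚ.* c n) ℚ.* (⟦ m ⟧ ℚ.* ⟦ n ⟧)     ≡⟨ *-interchange (c m) (c n) ⟦ m ⟧ ⟦ n ⟧ ⟩
  (c m ℚ.* ⟦ m ⟧) ℚ.* (c n ℚ.* ⟦ n ⟧)     ∎

lemma2 : (c : ℕ → ℚ)
           → c 1 ≡ 1ℚ
           → (∀ m n → Coprime m n → c (m * n) ≡ c m ℚ.* c n)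
           → (∀ p k → Prime p → 1 ≤ k → c (p ^ k) ≡ cPrimePower p k)
           → (D : ℕ) → 1 ≤ D → ⟦ sqPairCount D ⟧ ≡ c D ℚ.* ⟦ D ⟧
lemma2 c c1≡1 c-mult c-primePower D 1≤D =
  multiplicative-ext ℚ._*_ {⟦_⟧ ∘ sqPairCount} {λ n → c n ℚ.* ⟦ n ⟧}
    (⟦⟧∘-multiplicative {sqPairCount} sqPairCount-multiplicative) (*⟦⟧-multiplicative {c} (λ m n → c-mult m n))
    (sym (trans (cong (ℚ._* ⟦ 1 ⟧) c1≡1) (ℚ.*-identityˡ ⟦ 1 ⟧))) agree-primePower D {{>-nonZero 1≤D}}
  where
  agree-primePower : ∀ {p} → Prime p → ∀ k → ⟦ sqPairCount (p ^ suc k) ⟧ ≡ c (p ^ suc k) ℚ.* ⟦ p ^ suc k ⟧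
  agree-primePower {p} p-prime k = trans (⟦sqPairCount⟧-primePower p-prime k)
    (cong (ℚ._* ⟦ p ^ suc k ⟧) (sym (c-primePower p (suc k) p-prime (s≤s z≤n))))
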